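{- Let $G$ be an oriented graph derived from some Burling tree. Then there exist a Burling tree $(T,r,\lambda,c)$ and an induced subgraph $H$ of the oriented graph fully derived from $(T,r,\lambda,c)$ with $H$ isomorphic to $G$, such that: (i) $r\notin V(H)$; (ii) every non-leaf vertex of $T$ has exactly two children; (iii) no last-born of $T$ is in $V(H)$.
   Context: A Burling tree is a 4-tuple $(T,r,\lambda,c)$: $T$ a rooted tree with root $r$; $\lambda$ assigns to each non-leaf $v$ one of its children, its last-born; for $v\neq r$ not a last-born, $c(v)$ is the vertex set of a (possibly empty) branch (downward path $v_1\dots v_k$, each $v_i$ the parent of $v_{i+1}$) starting at the last-born of the parent of $v$, and $c(v)=\varnothing$ if $v$ is a last-born or the root. The oriented graph fully derived from it has vertex set $V(T)$ and arc $uv$ iff $v\in c(u)$; an oriented graph derived from it is any induced subgraph of this oriented graph. -}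

module Defs where

open import Data.Nat using (ℕ)
open import Data.Unit using (⊤)
open import Data.Fin using (Fin)
open import Data.List using (List; []; _∷_)
open import Data.List.Membership.Propositional using (_∈_)
open import Data.Product using (Σ; ∃; ∃-syntax; _×_; _,_)
open import Data.Sum using (_⊎_)
open import Relation.Binary.PropositionalEquality using (_≡_; _≢_)
open import Relation.Nullary using (¬_)
open import Function using (_⇔_)
open import Function.Definitions using (Injective)

iter : {A : Set} → (A → A) → ℕ → A → A
iter f ℕ.zero x = x
iter f (ℕ.suc k) x = f (iter f k x)

-- Every vertex reaches
-- the root by iterating parent, which makes the structure a rooted tree.
record RootedTree (n : ℕ) : Set where
  field
    root      : Fin n
    parent    : Fin n → Fin n
    parent-root : parent root ≡ root
    reaches-root : ∀ v → ∃[ k ] iter parent k v ≡ root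

  IsChild : Fin n → Fin n → Set
  IsChild v u = v ≢ root × parent v ≡ u

  IsLeaf : Fin n → Set
  IsLeaf u = ¬ (∃[ v ] IsChild v u)

  IsDownPathFrom : Fin n → List (Fin n) → Set
  IsDownPathFrom x [] = ⊤
  IsDownPathFrom x (y ∷ l) = IsChild y x × IsDownPathFrom y l

  IsBranch : List (Fin n) → Set
  IsBranch [] = ⊤
  IsBranch (x ∷ l) = IsDownPathFrom x l

record BurlingTree (n : ℕ) : Set where
  field
    tree : RootedTree n
  open RootedTree tree public
  field
    -- λ : last-born; only meaningful on non-leaves
    lastBorn : Fin n → Fin n
    lastBorn-child : ∀ u → ¬ IsLeaf u → IsChild (lastBorn u) u

  IsLastBorn : Fin n → Set
  IsLastBorn v = v ≢ root × lastBorn (parent v) ≡ v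

  field
    -- c(v), given as the list of vertices of the branch (in order)
    c : Fin n → List (Fin n)
    c-root : c root ≡ []
    c-lastBorn : ∀ v → IsLastBorn v → c v ≡ []
    c-branch : ∀ v → v ≢ root → ¬ IsLastBorn v →
      (c v ≡ []) ⊎
      (Σ (List (Fin n)) λ l → c v ≡ lastBorn (parent v) ∷ l × IsBranch (lastBorn (parent v) ∷ l))

  Arc : Fin n → Fin n → Set
  Arc u v = v ∈ c u

  Binary : Set
  Binary = ∀ u → ¬ IsLeaf u →
    ∃[ a ] ∃[ b ] a ≢ b × IsChild a u × IsChild b u ×
      (∀ v → IsChild v u → v ≡ a ⊎ v ≡ b)

-- An oriented graph on Fin m (arc relation E) is derived from the Burling
-- tree B if it is (isomorphic to) an induced subgraph of the fully derived
-- graph of B, i.e. via an injective map f : Fin m → V(T) that preserves and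
-- reflects arcs (the image of f is the induced subgraph).
DerivedVia : ∀ {m n} → (Fin m → Fin m → Set) → BurlingTree n → (Fin m → Fin n) → Set
DerivedVia E B f = Injective _≡_ _≡_ f × (∀ x y → E x y ⇔ BurlingTree.Arc B (f x) (f y))

-- Binarise T.  Each vertex w of T survives as copy w; below copy v hangs a spine
-- of last-borns spine v 0, …, spine v (n-1), spineEnd v, and the child of v placed
-- at position j (the last-born of v at the bottom) becomes the other child of
-- spine v j.  Free positions and the second child of every copy are padding leaves,
-- and a new root sits above copy r.  Copies are then neither the root nor
-- last-borns, every inner vertex has exactly two children, and a branch of T
-- starting at the last-born of p u becomes a branch starting at the last-born of
-- the parent of copy u whose copies are exactly the copies of the original branch,
-- so the arcs between copies are those of T.

module Submission where

open import Defs
open import Data.Nat using (ℕ; zero; suc; _+_; _*_; _∸_; _≤_; _<_; s≤s)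
open import Data.Nat.Properties using (+-suc; +-identityʳ; suc-injective; ≤-trans; m≤n⇒m≤1+n; n<1+n; m∸n≤m; m+[n∸m]≡n; +-∸-assoc)
open import Data.Fin using (Fin; zero; suc; toℕ; fromℕ; inject₁; lower₁; _≟_)
open import Data.Fin.Properties using (toℕ-injective; toℕ-inject₁; toℕ-fromℕ; toℕ<n; inject₁-lower₁; +↔⊎; *↔×)
open import Data.Fin.Permutation.Components using (transpose; transpose-inverse)
open import Data.List using (List; []; _∷_; map; _++_)
open import Data.List.Membership.Propositional using (_∈_)
open import Data.List.Membership.Propositional.Properties using (∈-map⁺; ∈-map⁻; ∈-++⁺ˡ; ∈-++⁺ʳ; ∈-++⁻)
open import Data.List.Relation.Unary.Any using (here; there)
open import Data.Product using (Σ; ∃; ∃-syntax; _×_; _,_; proj₁; proj₂)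
open import Data.Sum using (_⊎_; inj₁; inj₂)
import Data.Sum as Sum
open import Data.Sum.Function.Propositional using (_⊎-↔_)
open import Data.Unit using (⊤; tt)
open import Data.Empty using (⊥-elim)
open import Relation.Binary.PropositionalEquality
open import Relation.Nullary using (¬_; Dec; yes; no)
open import Relation.Nullary.Decidable using (dec-true; _×-dec_; ¬?)
open import Function using (_∘_; case_of_; _⇔_; mk⇔; _↔_; Inverse)
open import Function.Properties.Equivalence using () renaming (trans to ⇔-trans)
open import Function.Properties.Inverse using (↔-refl; ↔-sym; ↔-trans)

module TreeNotions {V : Set} (root : V) (parent : V → V) where
  IsChild : V → V → Set
  IsChild v u = v ≢ root × parent v ≡ u

  IsLeaf : V → Set
  IsLeaf u = ¬ (∃[ v ] IsChild v u)

  IsDownPathFrom : V → List V → Set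
  IsDownPathFrom x [] = ⊤
  IsDownPathFrom x (y ∷ l) = IsChild y x × IsDownPathFrom y l

  IsBranch : List V → Set
  IsBranch [] = ⊤
  IsBranch (x ∷ l) = IsDownPathFrom x l

record BurlingTreeOn (V : Set) : Set where
  field
    root : V
    parent : V → V
    parent-root : parent root ≡ root
    reaches-root : ∀ v → ∃[ k ] iter parent k v ≡ root
  open TreeNotions root parent public
  field
    lastBorn : V → V
    lastBorn-child : ∀ u → ¬ IsLeaf u → IsChild (lastBorn u) u

  IsLastBorn : V → Set
  IsLastBorn v = v ≢ root × lastBorn (parent v) ≡ v

  field
    c : V → List V
    c-root : c root ≡ []
    c-lastBorn : ∀ v → IsLastBorn v → c v ≡ []
    c-branch : ∀ v → v ≢ root → ¬ IsLastBorn v →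
      (c v ≡ []) ⊎
      (Σ (List V) λ l → c v ≡ lastBorn (parent v) ∷ l × IsBranch (lastBorn (parent v) ∷ l))

  Arc : V → V → Set
  Arc u v = v ∈ c u

  Binary : Set
  Binary = ∀ u → ¬ IsLeaf u →
    ∃[ a ] ∃[ b ] a ≢ b × IsChild a u × IsChild b u ×
      (∀ v → IsChild v u → v ≡ a ⊎ v ≡ b)

module Transport {V : Set} {N : ℕ} (V↔Fin : V ↔ Fin N) (B : BurlingTreeOn V) where
  open Inverse V↔Fin using (to; from; strictlyInverseˡ; strictlyInverseʳ)
  module B = BurlingTreeOn B

  to-injective : ∀ {x y} → to x ≡ to y → x ≡ y
  to-injective {x} {y} e = trans (sym (strictlyInverseʳ x)) (trans (cong from e) (strictlyInverseʳ y))

  parent : Fin N → Fin N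
  parent = to ∘ B.parent ∘ from

  iter-parent : ∀ k x → iter parent k (to x) ≡ to (iter B.parent k x)
  iter-parent zero x = refl
  iter-parent (suc k) x = trans (cong parent (iter-parent k x)) (cong (to ∘ B.parent) (strictlyInverseʳ _))

  rootedTree : RootedTree N
  rootedTree = record
    { root = to B.root
    ; parent = parent
    ; parent-root = cong to (trans (cong B.parent (strictlyInverseʳ _)) B.parent-root)
    ; reaches-root = λ y → let (k , e) = B.reaches-root (from y) in
        k , trans (cong (iter parent k) (sym (strictlyInverseˡ y))) (trans (iter-parent k (from y)) (cong to e))
    }

  module T = RootedTree rootedTree

  to-root : ∀ {x} → x ≢ B.root → to x ≢ T.root
  to-root x≢r e = x≢r (to-injective e)

  from-root : ∀ {y} → y ≢ T.root → from y ≢ B.root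
  from-root {y} y≢r e = y≢r (trans (sym (strictlyInverseˡ y)) (cong to e))

  to-child : ∀ {a b} → B.IsChild a b → T.IsChild (to a) (to b)
  to-child {a} (a≢r , pa) = to-root a≢r , cong to (trans (cong B.parent (strictlyInverseʳ a)) pa)

  from-child : ∀ {a b} → T.IsChild a b → B.IsChild (from a) (from b)
  from-child (a≢r , pa) = from-root a≢r , trans (sym (strictlyInverseʳ _)) (cong from pa)

  to-child′ : ∀ {a y} → B.IsChild a (from y) → T.IsChild (to a) y
  to-child′ {y = y} ch = subst (T.IsChild _) (strictlyInverseˡ y) (to-child ch)

  from-nonLeaf : ∀ {y} → ¬ T.IsLeaf y → ¬ B.IsLeaf (from y)
  from-nonLeaf nl bl = nl (λ (a , ch) → bl (from a , from-child ch))

  lastBorn : Fin N → Fin N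
  lastBorn = to ∘ B.lastBorn ∘ from

  IsLastBorn : Fin N → Set
  IsLastBorn v = v ≢ T.root × lastBorn (parent v) ≡ v

  from-lastBorn : ∀ {v} → IsLastBorn v → B.IsLastBorn (from v)
  from-lastBorn (v≢r , e) = from-root v≢r ,
    trans (cong B.lastBorn (sym (strictlyInverseʳ _))) (trans (sym (strictlyInverseʳ _)) (cong from e))

  to-lastBorn : ∀ {v} → B.IsLastBorn (from v) → IsLastBorn v
  to-lastBorn {v} (v≢r , e) = (λ e′ → v≢r (trans (cong from e′) (strictlyInverseʳ _))) ,
    trans (cong (to ∘ B.lastBorn) (strictlyInverseʳ _)) (trans (cong to e) (strictlyInverseˡ v))

  to-downPath : ∀ {x} l → B.IsDownPathFrom x l → T.IsDownPathFrom (to x) (map to l)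
  to-downPath [] _ = tt
  to-downPath (y ∷ l) (ch , p) = to-child ch , to-downPath l p

  c-branch : ∀ v → v ≢ T.root → ¬ IsLastBorn v →
    (map to (B.c (from v)) ≡ []) ⊎
    (Σ (List (Fin N)) λ l → map to (B.c (from v)) ≡ lastBorn (parent v) ∷ l × T.IsBranch (lastBorn (parent v) ∷ l))
  c-branch v v≢r ¬lb with B.c-branch (from v) (from-root v≢r) (¬lb ∘ to-lastBorn)
  ... | inj₁ e = inj₁ (cong (map to) e)
  ... | inj₂ (l , e , br) = inj₂ (map to l ,
        trans (cong (map to) e) (cong (λ z → to (B.lastBorn z) ∷ map to l) (sym (strictlyInverseʳ _))) ,
        subst (λ z → T.IsDownPathFrom (to (B.lastBorn z)) (map to l)) (sym (strictlyInverseʳ _)) (to-downPath l br))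

  burlingTree : BurlingTree N
  burlingTree = record
    { tree = rootedTree
    ; lastBorn = lastBorn
    ; lastBorn-child = λ y nl → to-child′ (B.lastBorn-child (from y) (from-nonLeaf nl))
    ; c = map to ∘ B.c ∘ from
    ; c-root = cong (map to) (trans (cong B.c (strictlyInverseʳ _)) B.c-root)
    ; c-lastBorn = λ v lb → cong (map to) (B.c-lastBorn (from v) (from-lastBorn lb))
    ; c-branch = c-branch
    }

  module BT = BurlingTree burlingTree

  to-binary : B.Binary → BT.Binary
  to-binary bin u nl with bin (from u) (from-nonLeaf nl)
  ... | a , b , a≢b , cha , chb , only =
    to a , to b , a≢b ∘ to-injective , to-child′ cha , to-child′ chb ,
    λ v ch → Sum.map back back (only (from v) (from-child ch))
    where
    back : ∀ {v w} → from v ≡ w → v ≡ to w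
    back {v} e = trans (sym (strictlyInverseˡ v)) (cong to e)

  to-arc : ∀ x y → B.Arc x y ⇔ BT.Arc (to x) (to y)
  to-arc x y = mk⇔
    (λ a → ∈-map⁺ to (subst (λ z → y ∈ B.c z) (sym (strictlyInverseʳ x)) a))
    (λ a → let (z , z∈ , e) = ∈-map⁻ to a in
      subst (_∈ B.c x) (to-injective (sym e)) (subst (λ w → z ∈ B.c w) (strictlyInverseʳ x) z∈))

  to-notLastBorn : ∀ {x} → ¬ B.IsLastBorn x → ¬ BT.IsLastBorn (to x)
  to-notLastBorn ¬lb lb = ¬lb (subst B.IsLastBorn (strictlyInverseʳ _) (from-lastBorn lb))

iter-suc : ∀ {A : Set} (f : A → A) k x → iter f (suc k) x ≡ iter f k (f x)
iter-suc f zero x = refl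
iter-suc f (suc k) x = cong f (iter-suc f k x)

iter-+ : ∀ {A : Set} (f : A → A) a b x → iter f (a + b) x ≡ iter f a (iter f b x)
iter-+ f zero b x = refl
iter-+ f (suc a) b x = cong f (iter-+ f a b x)

transpose-sends : ∀ {n} (i j : Fin n) → transpose i j i ≡ j
transpose-sends i j rewrite dec-true (i ≟ i) refl = refl

inject₁-of-≢fromℕ : ∀ {k} (j : Fin (suc k)) → j ≢ fromℕ k → ∃[ i ] j ≡ inject₁ i
inject₁-of-≢fromℕ {k} j j≢last = lower₁ j k≢j , sym (inject₁-lower₁ j k≢j)
  where
  k≢j : k ≢ toℕ j
  k≢j e = j≢last (toℕ-injective (trans (sym e) (sym (toℕ-fromℕ k))))

stepOr : ∀ {k} {A : Set} → A → (Fin (suc k) → A) → Fin (suc k) → A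
stepOr {zero} e x zero = e
stepOr {suc k} e x zero = x (suc zero)
stepOr {suc k} e x (suc j) = stepOr e (x ∘ suc) j

stepOr-last : ∀ {k} {A : Set} (e : A) x → stepOr {k} e x (fromℕ k) ≡ e
stepOr-last {zero} e x = refl
stepOr-last {suc k} e x = stepOr-last e (x ∘ suc)

stepOr-inject₁ : ∀ {k} {A : Set} (e : A) x (i : Fin k) → stepOr e x (inject₁ i) ≡ x (suc i)
stepOr-inject₁ {suc k} e x zero = refl
stepOr-inject₁ {suc k} e x (suc i) = stepOr-inject₁ e (x ∘ suc) i

stepOr-cases : ∀ {k} {A : Set} (e : A) x (j : Fin (suc k)) → stepOr e x j ≡ e ⊎ ∃[ i ] stepOr e x j ≡ x i
stepOr-cases {zero} e x zero = inj₁ refl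
stepOr-cases {suc k} e x zero = inj₂ (suc zero , refl)
stepOr-cases {suc k} e x (suc j) with stepOr-cases e (x ∘ suc) j
... | inj₁ q = inj₁ q
... | inj₂ (i , q) = inj₂ (suc i , q)

module Binarisation {k : ℕ} (B : BurlingTree (suc k)) where
  module T = BurlingTree B

  n : ℕ
  n = suc k

  r : Fin n
  r = T.root

  p L : Fin n → Fin n
  p = T.parent
  L = T.lastBorn

  last : Fin n
  last = fromℕ k

  -- The children of v sit at distinct positions along the spine of v; the
  -- transposition puts the last-born at the bottom position last.
  slot occupant : Fin n → Fin n → Fin n
  slot v = transpose (L v) last
  occupant v = transpose last (L v)

  occupant-slot : ∀ v w → occupant v (slot v w) ≡ w
  occupant-slot v w = transpose-inverse last (L v)

  slot-occupant : ∀ v j → slot v (occupant v j) ≡ j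
  slot-occupant v j = transpose-inverse (L v) last

  Vertex : Set
  Vertex = Fin 3 ⊎ Fin n ⊎ Fin n ⊎ (Fin n × Fin n) ⊎ (Fin n × Fin n)

  pattern top = inj₁ zero
  pattern topPad = inj₁ (suc zero)
  pattern rootPad = inj₁ (suc (suc zero))
  pattern copy w = inj₂ (inj₁ w)
  pattern spineEnd v = inj₂ (inj₂ (inj₁ v))
  pattern spine v j = inj₂ (inj₂ (inj₂ (inj₁ (v , j))))
  pattern pad v j = inj₂ (inj₂ (inj₂ (inj₂ (v , j))))

  isChild? : (w v : Fin n) → Dec (T.IsChild w v)
  isChild? w v = ¬? (w ≟ r) ×-dec (p w ≟ v)

  copyParent : (w : Fin n) → Dec (w ≡ r) → Vertex
  copyParent w (yes _) = top
  copyParent w (no _) = spine (p w) (slot (p w) w)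

  padParent : (v j : Fin n) → Dec (T.IsChild (occupant v j) v) → Vertex
  padParent v j (yes _) = copy (occupant v j)
  padParent v j (no _) = spine v j

  parent : Vertex → Vertex
  parent top = top
  parent topPad = top
  parent rootPad = copy r
  parent (copy w) = copyParent w (w ≟ r)
  parent (spineEnd v) = spine v last
  parent (spine v zero) = copy v
  parent (spine v (suc i)) = spine v (inject₁ i)
  parent (pad v j) = padParent v j (isChild? (occupant v j) v)

  spineNext : Fin n → Fin n → Vertex
  spineNext v = stepOr (spineEnd v) (spine v)

  spineNext-last : ∀ v → spineNext v last ≡ spineEnd v
  spineNext-last v = stepOr-last (spineEnd v) (spine v)

  spineNext-inject₁ : ∀ v i → spineNext v (inject₁ i) ≡ spine v (suc i)
  spineNext-inject₁ v i = stepOr-inject₁ (spineEnd v) (spine v) i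

  lastBorn : Vertex → Vertex
  lastBorn top = topPad
  lastBorn (copy w) = spine w zero
  lastBorn (spine v j) = spineNext v j
  lastBorn _ = top

  open TreeNotions top parent

  parent-copy-root : parent (copy r) ≡ top
  parent-copy-root with r ≟ r
  ... | yes _ = refl
  ... | no r≢r = ⊥-elim (r≢r refl)

  parent-copy : ∀ {w} → w ≢ r → parent (copy w) ≡ spine (p w) (slot (p w) w)
  parent-copy {w} w≢r with w ≟ r
  ... | yes e = ⊥-elim (w≢r e)
  ... | no _ = refl

  parent-copy-child : ∀ {w v} → T.IsChild w v → parent (copy w) ≡ spine v (slot v w)
  parent-copy-child (w≢r , refl) = parent-copy w≢r

  parent-copy-cases : ∀ w → (w ≡ r × parent (copy w) ≡ top) ⊎ (w ≢ r × parent (copy w) ≡ spine (p w) (slot (p w) w))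
  parent-copy-cases w with w ≟ r
  ... | yes e = inj₁ (e , refl)
  ... | no w≢r = inj₂ (w≢r , refl)

  parent-pad-cases : ∀ v j → (T.IsChild (occupant v j) v × parent (pad v j) ≡ copy (occupant v j))
                           ⊎ (¬ T.IsChild (occupant v j) v × parent (pad v j) ≡ spine v j)
  parent-pad-cases v j with isChild? (occupant v j) v
  ... | yes ch = inj₁ (ch , refl)
  ... | no ¬ch = inj₂ (¬ch , refl)

  data Inner : Vertex → Set where
    inner-top : Inner top
    inner-copy : ∀ w → Inner (copy w)
    inner-spine : ∀ v j → Inner (spine v j)

  parent-inner : ∀ x → Inner (parent x)
  parent-inner top = inner-top
  parent-inner topPad = inner-top
  parent-inner rootPad = inner-copy r
  parent-inner (copy w) with parent-copy-cases w
  ... | inj₁ (_ , e) = subst Inner (sym e) inner-top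
  ... | inj₂ (_ , e) = subst Inner (sym e) (inner-spine _ _)
  parent-inner (spineEnd v) = inner-spine v last
  parent-inner (spine v zero) = inner-copy v
  parent-inner (spine v (suc i)) = inner-spine v (inject₁ i)
  parent-inner (pad v j) with parent-pad-cases v j
  ... | inj₁ (_ , e) = subst Inner (sym e) (inner-copy _)
  ... | inj₂ (_ , e) = subst Inner (sym e) (inner-spine v j)

  outer-leaf : ∀ {u} → ¬ Inner u → IsLeaf u
  outer-leaf ¬inner (w , _ , e) = ¬inner (subst Inner e (parent-inner w))

  spineNext-child : ∀ v j → IsChild (spineNext v j) (spine v j)
  spineNext-child v j with j ≟ last
  ... | yes refl rewrite spineNext-last v = (λ ()) , refl
  ... | no j≢last with inject₁-of-≢fromℕ j j≢last
  ...   | i , refl rewrite spineNext-inject₁ v i = (λ ()) , refl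

  lastBorn-child : ∀ u → ¬ IsLeaf u → IsChild (lastBorn u) u
  lastBorn-child top _ = (λ ()) , refl
  lastBorn-child (copy w) _ = (λ ()) , refl
  lastBorn-child (spine v j) _ = spineNext-child v j
  lastBorn-child topPad nl = ⊥-elim (nl (outer-leaf λ ()))
  lastBorn-child rootPad nl = ⊥-elim (nl (outer-leaf λ ()))
  lastBorn-child (spineEnd v) nl = ⊥-elim (nl (outer-leaf λ ()))
  lastBorn-child (pad v j) nl = ⊥-elim (nl (outer-leaf λ ()))

  iter-spine : ∀ d v (a b : Fin n) → toℕ a + d ≡ toℕ b → iter parent d (spine v b) ≡ spine v a
  iter-spine zero v a b e = cong (spine v) (sym (toℕ-injective (trans (sym (+-identityʳ (toℕ a))) e)))
  iter-spine (suc d) v a zero e with trans (sym (+-suc (toℕ a) d)) e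
  ... | ()
  iter-spine (suc d) v a (suc i) e = trans (iter-suc parent d (spine v (suc i)))
    (iter-spine d v a (inject₁ i) (trans (suc-injective (trans (sym (+-suc (toℕ a) d)) e)) (sym (toℕ-inject₁ i))))

  iter-spine-stays : ∀ s v (b : Fin n) → s ≤ toℕ b → ∃[ a ] iter parent s (spine v b) ≡ spine v a
  iter-spine-stays zero v b _ = b , refl
  iter-spine-stays (suc s) v (suc i) (s≤s s≤i)
    with iter-spine-stays s v (inject₁ i) (subst (s ≤_) (sym (toℕ-inject₁ i)) s≤i)
  ... | a , e = a , trans (iter-suc parent s (spine v (suc i))) e

  iter-spine-copy : ∀ v b → iter parent (suc (toℕ b)) (spine v b) ≡ copy v
  iter-spine-copy v b = cong parent (iter-spine (toℕ b) v zero b refl)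

  climb : Fin n → ℕ
  climb w = suc (suc (toℕ (slot (p w) w)))

  iter-copy : ∀ {w} → w ≢ r → iter parent (climb w) (copy w) ≡ copy (p w)
  iter-copy {w} w≢r = begin
    iter parent (climb w) (copy w)                ≡⟨ iter-suc parent (suc (toℕ i)) (copy w) ⟩
    iter parent (suc (toℕ i)) (parent (copy w))   ≡⟨ cong (iter parent (suc (toℕ i))) (parent-copy w≢r) ⟩
    iter parent (suc (toℕ i)) (spine (p w) i)     ≡⟨ iter-spine-copy (p w) i ⟩
    copy (p w)                                    ∎
    where
    open ≡-Reasoning
    i = slot (p w) w

  Reaches : Vertex → Set
  Reaches x = ∃[ m ] iter parent m x ≡ top

  reaches-parent : ∀ x → Reaches (parent x) → Reaches x
  reaches-parent x (m , e) = suc m , trans (iter-suc parent m x) e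

  reaches-copy-by : ∀ d w → iter p d w ≡ r → Reaches (copy w)
  reaches-copy-by d w e with parent-copy-cases w
  reaches-copy-by d w e | inj₁ (_ , e′) = 1 , e′
  reaches-copy-by zero w e | inj₂ (w≢r , _) = ⊥-elim (w≢r e)
  reaches-copy-by (suc d) w e | inj₂ (w≢r , _) with reaches-copy-by d (p w) (trans (sym (iter-suc p d w)) e)
  ... | m , e′ = m + climb w ,
    trans (iter-+ parent m _ (copy w)) (trans (cong (iter parent m) (iter-copy w≢r)) e′)

  reaches-copy : ∀ w → Reaches (copy w)
  reaches-copy w = let (d , e) = T.reaches-root w in reaches-copy-by d w e

  reaches-spine : ∀ v b → Reaches (spine v b)
  reaches-spine v b = let (m , e) = reaches-copy v in m + suc (toℕ b) ,
    trans (iter-+ parent m _ (spine v b)) (trans (cong (iter parent m) (iter-spine-copy v b)) e)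

  reaches : ∀ x → Reaches x
  reaches top = 0 , refl
  reaches topPad = 1 , refl
  reaches rootPad = reaches-parent rootPad (reaches-copy r)
  reaches (copy w) = reaches-copy w
  reaches (spineEnd v) = reaches-parent (spineEnd v) (reaches-spine v last)
  reaches (spine v b) = reaches-spine v b
  reaches (pad v j) with parent-pad-cases v j
  ... | inj₁ (_ , e) = reaches-parent (pad v j) (subst Reaches (sym e) (reaches-copy _))
  ... | inj₂ (_ , e) = reaches-parent (pad v j) (subst Reaches (sym e) (reaches-spine v j))

  copyPad : Fin n → Vertex
  copyPad w with w ≟ r
  ... | yes _ = rootPad
  ... | no _ = pad (p w) (slot (p w) w)

  spineChild : Fin n → Fin n → Vertex
  spineChild v j with isChild? (occupant v j) v
  ... | yes _ = copy (occupant v j)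
  ... | no _ = pad v j

  occupant-of-child : ∀ {w} → T.IsChild w (p w) → T.IsChild (occupant (p w) (slot (p w) w)) (p w)
  occupant-of-child {w} ch = subst (λ z → T.IsChild z (p w)) (sym (occupant-slot (p w) w)) ch

  copyPad-child : ∀ w → IsChild (copyPad w) (copy w)
  copyPad-child w with w ≟ r
  ... | yes refl = (λ ()) , refl
  ... | no w≢r with parent-pad-cases (p w) (slot (p w) w)
  ...   | inj₁ (_ , e) = (λ ()) , trans e (cong copy (occupant-slot (p w) w))
  ...   | inj₂ (¬ch , _) = ⊥-elim (¬ch (occupant-of-child (w≢r , refl)))

  spineChild-cases : ∀ v j → (T.IsChild (occupant v j) v × spineChild v j ≡ copy (occupant v j))
                           ⊎ (¬ T.IsChild (occupant v j) v × spineChild v j ≡ pad v j)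
  spineChild-cases v j with isChild? (occupant v j) v
  ... | yes ch = inj₁ (ch , refl)
  ... | no ¬ch = inj₂ (¬ch , refl)

  spineChild-child : ∀ v j → IsChild (spineChild v j) (spine v j)
  spineChild-child v j with spineChild-cases v j | parent-pad-cases v j
  ... | inj₁ (ch , e) | _ = (λ e′ → case trans (sym e) e′ of λ ()) ,
    trans (cong parent e) (trans (parent-copy-child ch) (cong (spine v) (slot-occupant v j)))
  ... | inj₂ (_ , e) | inj₂ (_ , e′) = (λ e″ → case trans (sym e) e″ of λ ()) , trans (cong parent e) e′
  ... | inj₂ (¬ch , _) | inj₁ (ch , _) = ⊥-elim (¬ch ch)

  spineChild≢spineNext : ∀ v j → spineChild v j ≢ spineNext v j
  spineChild≢spineNext v j e with spineChild-cases v j | stepOr-cases (spineEnd v) (spine v) j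
  ... | inj₁ (_ , e₁) | inj₁ e₂ with () ← trans (sym e₁) (trans e e₂)
  ... | inj₁ (_ , e₁) | inj₂ (_ , e₂) with () ← trans (sym e₁) (trans e e₂)
  ... | inj₂ (_ , e₁) | inj₁ e₂ with () ← trans (sym e₁) (trans e e₂)
  ... | inj₂ (_ , e₁) | inj₂ (_ , e₂) with () ← trans (sym e₁) (trans e e₂)

  children-top : ∀ x → IsChild x top → x ≡ copy r ⊎ x ≡ topPad
  children-top top (x≢top , _) = ⊥-elim (x≢top refl)
  children-top topPad _ = inj₂ refl
  children-top rootPad (_ , ())
  children-top (spineEnd v) (_ , ())
  children-top (copy w) (_ , e) with parent-copy-cases w
  ... | inj₁ (w≡r , _) = inj₁ (cong copy w≡r)
  ... | inj₂ (_ , e′) with () ← trans (sym e′) e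
  children-top (spine v zero) (_ , ())
  children-top (spine v (suc i)) (_ , ())
  children-top (pad v j) (_ , e) with parent-pad-cases v j
  ... | inj₁ (_ , e′) with () ← trans (sym e′) e
  ... | inj₂ (_ , e′) with () ← trans (sym e′) e

  children-copy : ∀ w x → IsChild x (copy w) → x ≡ spine w zero ⊎ x ≡ copyPad w
  children-copy w top (x≢top , _) = ⊥-elim (x≢top refl)
  children-copy w rootPad (_ , refl) with r ≟ r
  ... | yes _ = inj₂ refl
  ... | no r≢r = ⊥-elim (r≢r refl)
  children-copy w (copy w′) (_ , e) with parent-copy-cases w′
  ... | inj₁ (_ , e′) with () ← trans (sym e′) e
  ... | inj₂ (_ , e′) with () ← trans (sym e′) e
  children-copy w (spine v zero) (_ , refl) = inj₁ refl
  children-copy w (spine v (suc i)) (_ , ())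
  children-copy w (pad v j) (_ , e) with parent-pad-cases v j
  ... | inj₂ (_ , e′) with () ← trans (sym e′) e
  ... | inj₁ ((o≢r , po) , e′) with trans (sym e′) e
  ...   | refl with occupant v j ≟ r
  ...     | yes o≡r = ⊥-elim (o≢r o≡r)
  ...     | no _ = inj₂ (sym (subst (λ z → pad z (slot z (occupant v j)) ≡ pad v j) (sym po)
                                      (cong (pad v) (slot-occupant v j))))

  children-spine : ∀ v j x → IsChild x (spine v j) → x ≡ spineChild v j ⊎ x ≡ spineNext v j
  children-spine v j top (x≢top , _) = ⊥-elim (x≢top refl)
  children-spine v j topPad (_ , ())
  children-spine v j rootPad (_ , ())
  children-spine v j (copy w) (_ , e) with parent-copy-cases w
  ... | inj₁ (_ , e′) with () ← trans (sym e′) e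
  ... | inj₂ (w≢r , e′) with trans (sym e′) e
  ...   | refl with spineChild-cases (p w) (slot (p w) w)
  ...     | inj₁ (_ , e″) = inj₁ (sym (trans e″ (cong copy (occupant-slot (p w) w))))
  ...     | inj₂ (¬ch , _) = ⊥-elim (¬ch (occupant-of-child (w≢r , refl)))
  children-spine v j (spineEnd w) (_ , refl) = inj₂ (sym (spineNext-last w))
  children-spine v j (spine w zero) (_ , ())
  children-spine v j (spine w (suc i)) (_ , refl) = inj₂ (sym (spineNext-inject₁ w i))
  children-spine v j (pad w j′) (_ , e) with parent-pad-cases w j′
  ... | inj₁ (_ , e′) with () ← trans (sym e′) e
  ... | inj₂ (¬ch , e′) with trans (sym e′) e
  ...   | refl with spineChild-cases w j′
  ...     | inj₁ (ch , _) = ⊥-elim (¬ch ch)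
  ...     | inj₂ (_ , e″) = inj₁ (sym e″)

  binary : ∀ u → ¬ IsLeaf u →
    ∃[ a ] ∃[ b ] a ≢ b × IsChild a u × IsChild b u × (∀ v → IsChild v u → v ≡ a ⊎ v ≡ b)
  binary top _ = copy r , topPad , (λ ()) , ((λ ()) , parent-copy-root) , ((λ ()) , refl) , children-top
  binary (copy w) _ = spine w zero , copyPad w , spine≢copyPad , ((λ ()) , refl) , copyPad-child w , children-copy w
    where
    spine≢copyPad : spine w zero ≢ copyPad w
    spine≢copyPad with w ≟ r
    ... | yes _ = λ ()
    ... | no _ = λ ()
  binary (spine v j) _ = spineChild v j , spineNext v j , spineChild≢spineNext v j ,
    spineChild-child v j , spineNext-child v j , children-spine v j
  binary topPad nl = ⊥-elim (nl (outer-leaf λ ()))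
  binary rootPad nl = ⊥-elim (nl (outer-leaf λ ()))
  binary (spineEnd v) nl = ⊥-elim (nl (outer-leaf λ ()))
  binary (pad v j) nl = ⊥-elim (nl (outer-leaf λ ()))

  upPath : ℕ → Vertex → List Vertex
  upPath zero x = []
  upPath (suc t) x = iter parent t x ∷ upPath t x

  upPath-downPath : ∀ t x tail → (∀ s → s < t → iter parent s x ≢ top) →
    IsDownPathFrom x tail → IsDownPathFrom (iter parent t x) (upPath t x ++ tail)
  upPath-downPath zero x tail _ path = path
  upPath-downPath (suc t) x tail ≢top path =
    (≢top t (n<1+n t) , refl) , upPath-downPath t x tail (λ s s<t → ≢top s (m≤n⇒m≤1+n s<t)) path

  ∈-upPath : ∀ {t x y} → y ∈ upPath t x → ∃[ s ] s < t × y ≡ iter parent s x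
  ∈-upPath {suc t} (here e) = t , n<1+n t , e
  ∈-upPath {suc t} (there y∈) with ∈-upPath y∈
  ... | s , s<t , e = s , m≤n⇒m≤1+n s<t , e

  upPath-∋ : ∀ t x → x ∈ upPath (suc t) x
  upPath-∋ zero x = here refl
  upPath-∋ (suc t) x = there (upPath-∋ t x)

  climb-stays : ∀ {w} → w ≢ r → ∀ s → s < climb w →
    iter parent s (copy w) ≡ copy w ⊎ ∃[ a ] iter parent s (copy w) ≡ spine (p w) a
  climb-stays w≢r zero _ = inj₁ refl
  climb-stays {w} w≢r (suc s) (s≤s (s≤s s≤i)) with iter-spine-stays s (p w) (slot (p w) w) s≤i
  ... | a , e = inj₂ (a , trans (iter-suc parent s (copy w)) (trans (cong (iter parent s) (parent-copy w≢r)) e))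

  climb-≢top : ∀ {w} → w ≢ r → ∀ s → s < climb w → iter parent s (copy w) ≢ top
  climb-≢top w≢r s s<climb e with climb-stays w≢r s s<climb
  ... | inj₁ e′ with () ← trans (sym e′) e
  ... | inj₂ (_ , e′) with () ← trans (sym e′) e

  climb-copies : ∀ {w b} → w ≢ r → ∀ s → s < climb w → copy b ≡ iter parent s (copy w) → b ≡ w
  climb-copies w≢r s s<climb e with climb-stays w≢r s s<climb
  ... | inj₁ e′ with refl ← trans e e′ = refl
  ... | inj₂ (_ , e′) with () ← trans e e′

  downSegments : Fin n → List (Fin n) → List Vertex
  downSegments y [] = []
  downSegments y (z ∷ zs) = upPath (climb z) (copy z) ++ downSegments z zs

  downSegments-downPath : ∀ y l → T.IsDownPathFrom y l → IsDownPathFrom (copy y) (downSegments y l)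
  downSegments-downPath y [] _ = tt
  downSegments-downPath y (z ∷ zs) ((z≢r , pz) , path) =
    subst (λ q → IsDownPathFrom q (downSegments y (z ∷ zs))) (trans (iter-copy z≢r) (cong copy pz))
      (upPath-downPath (climb z) (copy z) (downSegments z zs) (climb-≢top z≢r) (downSegments-downPath z zs path))

  ∈-downSegments : ∀ {b} y l → T.IsDownPathFrom y l → copy b ∈ downSegments y l → b ∈ l
  ∈-downSegments y (z ∷ zs) ((z≢r , _) , path) b∈ with ∈-++⁻ (upPath (climb z) (copy z)) b∈
  ... | inj₂ b∈′ = there (∈-downSegments z zs path b∈′)
  ... | inj₁ b∈′ with ∈-upPath b∈′
  ...   | s , s<climb , e = here (climb-copies z≢r s s<climb e)

  downSegments-∋ : ∀ {b} y l → b ∈ l → copy b ∈ downSegments y l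
  downSegments-∋ y (z ∷ zs) (here refl) = ∈-++⁺ˡ (upPath-∋ (suc (toℕ (slot (p z) z))) (copy z))
  downSegments-∋ y (z ∷ zs) (there b∈) = ∈-++⁺ʳ (upPath (climb z) (copy z)) (downSegments-∋ z zs b∈)

  -- A branch L(p u), z₁, …, zₘ of T becomes the path from the spine vertex just
  -- below the position of u, down the spine of p u to copy L(p u), followed by
  -- the spine segments leading to copy z₁, …, copy zₘ.
  translate : Fin n → List (Fin n) → List Vertex
  translate u [] = []
  translate u (y ∷ ys) = upPath (suc (k ∸ toℕ (slot (p u) u))) (copy y) ++ downSegments y ys

  NonEmptyC : Fin n → List (Fin n) → Set
  NonEmptyC u cl = u ≢ r × ¬ T.IsLastBorn u × Σ (List (Fin n)) λ l → cl ≡ L (p u) ∷ l × T.IsDownPathFrom (L (p u)) l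

  c-cases : ∀ u → T.c u ≡ [] ⊎ NonEmptyC u (T.c u)
  c-cases u with u ≟ r
  ... | yes refl = inj₁ T.c-root
  ... | no u≢r with L (p u) ≟ u
  ...   | yes e = inj₁ (T.c-lastBorn u (u≢r , e))
  ...   | no ¬lb with T.c-branch u u≢r (¬lb ∘ proj₂)
  ...     | inj₁ e = inj₁ e
  ...     | inj₂ (l , e , br) = inj₂ (u≢r , ¬lb ∘ proj₂ , l , e , br)

  module FirstSegment (u : Fin n) (u≢r : u ≢ r) (¬lb : ¬ T.IsLastBorn u) where
    i : Fin n
    i = slot (p u) u

    Lp : Fin n
    Lp = L (p u)

    length : ℕ
    length = k ∸ toℕ i

    Lp-child : T.IsChild Lp (p u)
    Lp-child = T.lastBorn-child (p u) (λ leaf → leaf (u , u≢r , refl))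

    Lp≢r : Lp ≢ r
    Lp≢r = proj₁ Lp-child

    i≢last : i ≢ last
    i≢last e = ¬lb (u≢r , trans (sym (transpose-sends last Lp)) (trans (cong (occupant (p u)) (sym e)) (occupant-slot (p u) u)))

    i′ : Fin k
    i′ = proj₁ (inject₁-of-≢fromℕ i i≢last)

    i≡i′ : i ≡ inject₁ i′
    i≡i′ = proj₂ (inject₁-of-≢fromℕ i i≢last)

    slot-Lp : toℕ (slot (p Lp) Lp) ≡ k
    slot-Lp = trans (cong (λ z → toℕ (slot z Lp)) (proj₂ Lp-child))
                    (trans (cong toℕ (transpose-sends Lp last)) (toℕ-fromℕ k))

    within-climb : ∀ s → s < suc length → s < climb Lp
    within-climb s (s≤s s≤length) = s≤s (m≤n⇒m≤1+n (subst (s ≤_) (sym slot-Lp) (≤-trans s≤length (m∸n≤m k (toℕ i)))))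

    i′<k : suc (toℕ i′) ≤ k
    i′<k = toℕ<n i′

    length-suc : length ≡ suc (k ∸ suc (toℕ i′))
    length-suc = trans (cong (k ∸_) (trans (cong toℕ i≡i′) (toℕ-inject₁ i′))) (+-∸-assoc 1 i′<k)

    parent-copy-Lp : parent (copy Lp) ≡ spine (p u) last
    parent-copy-Lp = trans (parent-copy-child Lp-child) (cong (spine (p u)) (transpose-sends Lp last))

    head-of-segment : iter parent length (copy Lp) ≡ spine (p u) (suc i′)
    head-of-segment rewrite length-suc = begin
      iter parent (suc m′) (copy Lp)        ≡⟨ iter-suc parent m′ (copy Lp) ⟩
      iter parent m′ (parent (copy Lp))     ≡⟨ cong (iter parent m′) parent-copy-Lp ⟩
      iter parent m′ (spine (p u) last)     ≡⟨ iter-spine m′ (p u) (suc i′) last (trans (m+[n∸m]≡n i′<k) (sym (toℕ-fromℕ k))) ⟩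
      spine (p u) (suc i′)                  ∎
      where
      open ≡-Reasoning
      m′ = k ∸ suc (toℕ i′)

    lastBorn-parent-copy : lastBorn (parent (copy u)) ≡ spine (p u) (suc i′)
    lastBorn-parent-copy = trans (cong lastBorn (parent-copy u≢r)) (trans (cong (spineNext (p u)) i≡i′) (spineNext-inject₁ (p u) i′))

    starts-below-u : iter parent length (copy Lp) ≡ lastBorn (parent (copy u))
    starts-below-u = trans head-of-segment (sym lastBorn-parent-copy)

  translate-branch : ∀ u cl → cl ≡ [] ⊎ NonEmptyC u cl →
    (translate u cl ≡ []) ⊎
    (Σ (List Vertex) λ l → translate u cl ≡ lastBorn (parent (copy u)) ∷ l × IsDownPathFrom (lastBorn (parent (copy u))) l)
  translate-branch u .[] (inj₁ refl) = inj₁ refl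
  translate-branch u .(L (p u) ∷ l) (inj₂ (u≢r , ¬lb , l , refl , path)) =
    inj₂ (tail , cong (_∷ tail) starts-below-u ,
          subst (λ z → IsDownPathFrom z tail) starts-below-u
            (upPath-downPath length (copy Lp) (downSegments Lp l)
              (λ s s<length → climb-≢top Lp≢r s (within-climb s (m≤n⇒m≤1+n s<length)))
              (downSegments-downPath Lp l path)))
    where
    open FirstSegment u u≢r ¬lb
    tail = upPath length (copy Lp) ++ downSegments Lp l

  translate-∈ : ∀ a b cl → cl ≡ [] ⊎ NonEmptyC a cl → b ∈ cl ⇔ copy b ∈ translate a cl
  translate-∈ a b .[] (inj₁ refl) = mk⇔ (λ ()) (λ ())
  translate-∈ a b .(L (p a) ∷ l) (inj₂ (a≢r , ¬lb , l , refl , path)) = mk⇔ forth back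
    where
    open FirstSegment a a≢r ¬lb
    forth : b ∈ Lp ∷ l → copy b ∈ upPath (suc length) (copy Lp) ++ downSegments Lp l
    forth (here refl) = ∈-++⁺ˡ (upPath-∋ length (copy Lp))
    forth (there b∈) = ∈-++⁺ʳ (upPath (suc length) (copy Lp)) (downSegments-∋ Lp l b∈)
    back : copy b ∈ upPath (suc length) (copy Lp) ++ downSegments Lp l → b ∈ Lp ∷ l
    back b∈ with ∈-++⁻ (upPath (suc length) (copy Lp)) b∈
    ... | inj₂ b∈′ = there (∈-downSegments Lp l path b∈′)
    ... | inj₁ b∈′ with ∈-upPath b∈′
    ...   | s , s<length , e = here (climb-copies Lp≢r s (within-climb s s<length) e)

  lastBorn-parent-copy≢copy : ∀ u → lastBorn (parent (copy u)) ≢ copy u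
  lastBorn-parent-copy≢copy u e with parent-copy-cases u
  ... | inj₁ (_ , e′) with () ← trans (sym (cong lastBorn e′)) e
  ... | inj₂ (_ , e′) with stepOr-cases (spineEnd (p u)) (spine (p u)) (slot (p u) u)
  ...   | inj₁ e″ with () ← trans (sym e″) (trans (sym (cong lastBorn e′)) e)
  ...   | inj₂ (_ , e″) with () ← trans (sym e″) (trans (sym (cong lastBorn e′)) e)

  c : Vertex → List Vertex
  c (copy u) = translate u (T.c u)
  c _ = []

  IsLastBorn : Vertex → Set
  IsLastBorn v = v ≢ top × lastBorn (parent v) ≡ v

  c-lastBorn : ∀ v → IsLastBorn v → c v ≡ []
  c-lastBorn (copy u) (_ , e) = ⊥-elim (lastBorn-parent-copy≢copy u e)
  c-lastBorn top _ = refl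
  c-lastBorn topPad _ = refl
  c-lastBorn rootPad _ = refl
  c-lastBorn (spineEnd _) _ = refl
  c-lastBorn (spine _ _) _ = refl
  c-lastBorn (pad _ _) _ = refl

  c-branch : ∀ v → v ≢ top → ¬ IsLastBorn v →
    (c v ≡ []) ⊎ (Σ (List Vertex) λ l → c v ≡ lastBorn (parent v) ∷ l × IsBranch (lastBorn (parent v) ∷ l))
  c-branch (copy u) _ _ = translate-branch u (T.c u) (c-cases u)
  c-branch top _ _ = inj₁ refl
  c-branch topPad _ _ = inj₁ refl
  c-branch rootPad _ _ = inj₁ refl
  c-branch (spineEnd _) _ _ = inj₁ refl
  c-branch (spine _ _) _ _ = inj₁ refl
  c-branch (pad _ _) _ _ = inj₁ refl

  binarised : BurlingTreeOn Vertex
  binarised = record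
    { root = top ; parent = parent ; parent-root = refl ; reaches-root = reaches
    ; lastBorn = lastBorn ; lastBorn-child = lastBorn-child
    ; c = c ; c-root = refl ; c-lastBorn = c-lastBorn ; c-branch = c-branch
    }

  arc-copy : ∀ a b → T.Arc a b ⇔ BurlingTreeOn.Arc binarised (copy a) (copy b)
  arc-copy a b = translate-∈ a b (T.c a) (c-cases a)

  copy-notLastBorn : ∀ w → ¬ BurlingTreeOn.IsLastBorn binarised (copy w)
  copy-notLastBorn w = lastBorn-parent-copy≢copy w ∘ proj₂

  size : ℕ
  size = 3 + (n + (n + (n * n + n * n)))

  Vertex↔Fin : Vertex ↔ Fin size
  Vertex↔Fin = ↔-sym (sumFin ↔-refl (sumFin ↔-refl (sumFin ↔-refl (sumFin *↔× *↔×))))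
    where
    sumFin : ∀ {a b} {A B : Set} → Fin a ↔ A → Fin b ↔ B → Fin (a + b) ↔ (A ⊎ B)
    sumFin I J = ↔-trans +↔⊎ (I ⊎-↔ J)

lemma3p5 : (m : ℕ) (E : Fin m → Fin m → Set) →
    (∃[ n ] Σ (BurlingTree n) λ B → ∃[ f ] DerivedVia E B f) →
    ∃[ n ] Σ (BurlingTree n) λ B → ∃[ g ] (DerivedVia E B g ×
      (∀ x → g x ≢ BurlingTree.root B) ×
      BurlingTree.Binary B ×
      (∀ x → ¬ BurlingTree.IsLastBorn B (g x)))
lemma3p5 m E (zero , B , _) with () ← BurlingTree.root B
lemma3p5 m E (suc k , B , f , f-injective , f-arcs) =
  _ , burlingTree , g ,
  ((λ e → f-injective (copy-injective (to-injective e))) , arcs) ,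
  (λ x → to-root {copy (f x)} λ ()) ,
  to-binary binary ,
  (λ x → to-notLastBorn (copy-notLastBorn (f x)))
  where
  open Binarisation B
  open Transport Vertex↔Fin binarised
  g : Fin m → Fin size
  g x = Inverse.to Vertex↔Fin (copy (f x))
  copy-injective : ∀ {a b} → copy a ≡ copy b → a ≡ b
  copy-injective refl = refl
  arcs : ∀ x y → E x y ⇔ BT.Arc (g x) (g y)
  arcs x y = ⇔-trans (f-arcs x y) (⇔-trans (arc-copy (f x) (f y)) (to-arc (copy (f x)) (copy (f y))))
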